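{- For any real number $k\ge2$, $D_2(k)$ is the minimum integer $z$ which is suitable for $k$.
   Context: Let $k\ge2$ be real and $K=\lfloor k\rfloor+1$. For $\mathbf{x}=(x_1,\dots,x_d)\in\mathbb{Z}_{>0}^d$, let $a_K(\mathbf{x})=d+|\{i:x_i<K\}|$, $b_K(\mathbf{x})=1+\sum_{i:x_i<K}1/x_i$, $\mathrm{aad}^*_K(\mathbf{x})=a_K(\mathbf{x})/b_K(\mathbf{x})$. $D_2(k)$ is the minimum integer $z$ such that there exist an integer $d\ge K$ and $\mathbf{x}\in\mathbb{Z}_{\ge2}^d$ with $\sum_i x_i=z$ and $\mathrm{aad}^*_K(\mathbf{x})>k$. A positive integer $z$ is suitable for $k$ if either $z\ge K^2$ or there exist integers $d$ and $s$ such that: (S1) $K\le d\le z/2$; (S2) $0\le s\le d-1$; (S3) $Ks+2(d-s)\le z\le Ks+(K-1)(d-s)$; (S4) writing $q=\lfloor (z-Ks)/(d-s)\rfloor$, $d_1=(z-Ks)\bmod (d-s)$ and $d_0=d-s-d_1$, we have $\frac{d+d_0+d_1}{1+d_0/q+d_1/(q+1)}>k$. -}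

module Defs where

open import Data.Nat as ℕ using (ℕ; zero; suc; _+_; _*_; _∸_; _≤_; _<ᵇ_)
open import Data.Nat.DivMod using (_/_; _%_)
open import Data.Bool using (if_then_else_)
open import Data.Integer using (+_; +[1+_])
open import Data.Rational as ℚ using (ℚ; mkℚ; 0ℚ; 1ℚ; 1/_)
open import Data.Vec using (Vec; []; _∷_)
open import Data.Vec.Relation.Unary.All using (All)
open import Data.Product using (Σ; _×_; ∃)
open import Relation.Nullary using (¬_)

-- A real number k is represented by its strict upper cut
-- Gt q  :⇔  q > k   (q rational).  Classically these open, upward-closed,
-- inhabited, bounded-below subsets of ℚ are exactly the real numbers.
record Real : Set₁ where
  field
    Gt        : ℚ → Set
    upward    : ∀ {p q} → p ℚ.< q → Gt p → Gt q
    rounded   : ∀ {q} → Gt q → ∃ λ r → r ℚ.< q × Gt r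
    inhabited : ∃ λ q → Gt q
    bounded   : ∃ λ q → ¬ Gt q
open Real public

ℕtoℚ : ℕ → ℚ
ℕtoℚ n = (+ n) ℚ./ 1

-- 1/x, with the (never used) convention 1/0 = 0
inv : ℕ → ℚ
inv zero    = 0ℚ
inv (suc n) = (+ 1) ℚ./ suc n

-- p / q for a rational q; the convention p / q = 0 when q ≤ 0 is never used
-- below, since all denominators are ≥ 1.
recip : ℚ → ℚ
recip q@(mkℚ +[1+ n ] _ _) = 1/ q
recip _ = 0ℚ

_÷'_ : ℚ → ℚ → ℚ
p ÷' q = p ℚ.* recip q

-- natural division / remainder, with conventions for divisor 0 (never used)
ndiv : ℕ → ℕ → ℕ
ndiv m zero    = 0
ndiv m (suc n) = m / suc n

nmod : ℕ → ℕ → ℕ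
nmod m zero    = m
nmod m (suc n) = m % suc n

smallCount : ∀ {d} → ℕ → Vec ℕ d → ℕ
smallCount K []       = 0
smallCount K (x ∷ xs) = (if x <ᵇ K then 1 else 0) + smallCount K xs

smallInvSum : ∀ {d} → ℕ → Vec ℕ d → ℚ
smallInvSum K []       = 0ℚ
smallInvSum K (x ∷ xs) = (if x <ᵇ K then inv x else 0ℚ) ℚ.+ smallInvSum K xs

vsum : ∀ {d} → Vec ℕ d → ℕ
vsum []       = 0
vsum (x ∷ xs) = x + vsum xs

aK : ∀ {d} → ℕ → Vec ℕ d → ℕ
aK {d} K x = d + smallCount K x

bK : ∀ {d} → ℕ → Vec ℕ d → ℚ
bK K x = 1ℚ ℚ.+ smallInvSum K x

aad* : ∀ {d} → ℕ → Vec ℕ d → ℚ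
aad* K x = ℕtoℚ (aK K x) ÷' bK K x

IsFloorSucc : Real → ℕ → Set
IsFloorSucc k K = Gt k (ℕtoℚ K) × ¬ Gt k (ℕtoℚ (K ∸ 1))

D2Prop : Real → ℕ → ℕ → Set
D2Prop k K z =
  Σ ℕ λ d → K ≤ d × Σ (Vec ℕ d) λ x →
    All (2 ≤_) x × vsum x ≡' z × Gt k (aad* K x)
  where
  open import Relation.Binary.PropositionalEquality renaming (_≡_ to _≡'_)

S4value : ℕ → ℕ → ℕ → ℕ → ℚ
S4value K z d s =
  ℕtoℚ (d + d0 + d1) ÷' (1ℚ ℚ.+ (ℕtoℚ d0 ℚ.* inv q) ℚ.+ (ℕtoℚ d1 ℚ.* inv (suc q)))
  where
  q  = ndiv (z ∸ K * s) (d ∸ s)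
  d1 = nmod (z ∸ K * s) (d ∸ s)
  d0 = d ∸ s ∸ d1

Suitable : Real → ℕ → ℕ → Set
Suitable k K z =
  1 ≤ z × ( K * K ≤ z ⊎
    Σ ℕ λ d → Σ ℕ λ s →
      (K ≤ d × 2 * d ≤ z) ×
      (s ℕ.< d) ×
      (K * s + 2 * (d ∸ s) ≤ z × z ≤ K * s + (K ∸ 1) * (d ∸ s)) ×
      Gt k (S4value K z d s) )
  where open import Data.Sum using (_⊎_)

IsMin : (ℕ → Set) → ℕ → Set
IsMin P z = P z × (∀ w → P w → z ≤ w)

module Submission where

-- Each witness of either property yields a witness of the other that is no larger, so the
-- two minima coincide. Entries xᵢ ≥ K do not enter b_K, so a vector x with aad*_K(x) > k may
-- replace them by K; with s of them and m small entries of sum S, this gives z = K s + S ≤ Σ x.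
-- Since 1/x lies above its chord over [q, q + 1] at every integer x, summing that linear bound
-- with q = ⌊S/m⌋ shows that the balanced m-tuple (d₁ entries q + 1, d₀ entries q) has the least
-- Σ 1/xᵢ among m-tuples with sum S; so (S4) holds for z. Conversely, (S4) is exactly aad* of
-- s copies of K followed by that balanced tuple, and for z ≥ K² the vector (K, …, K) of length
-- K has aad* = K > k.

open import Defs
open import Data.Bool using (true; false; if_then_else_)
open import Data.Empty using (⊥-elim)
open import Data.Integer as ℤ using (+[1+_])
import Data.Integer.Properties as ℤP
open import Data.Nat as ℕ using (ℕ; zero; suc; _+_; _*_; _∸_; _≤_; _<_; _<ᵇ_; z≤n; s≤s; _≤?_)
import Data.Nat.Coprimality as Coprime
open import Data.Nat.DivMod using (m≡m%n+[m/n]*n; m%n<n)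
import Data.Nat.Properties as ℕP
open import Algebra.Properties.CommutativeSemigroup ℕP.+-commutativeSemigroup using (x∙yz≈y∙xz)
import Data.Nat.Solver as ℕSolver
open import Data.Product using (Σ; _×_; _,_)
open import Data.Rational as ℚ using (ℚ; mkℚ; 0ℚ; 1ℚ)
import Data.Rational.Properties as ℚP
import Data.Rational.Solver as ℚSolver
open import Data.Sum as Sum using (_⊎_; inj₁; inj₂)
open import Data.Vec using (Vec; []; _∷_; _++_; replicate)
open import Data.Vec.Relation.Unary.All as All using (All; []; _∷_)
open import Data.Vec.Relation.Unary.All.Properties using (++⁺)
open import Function.Bundles using (_⇔_; mk⇔)
open import Relation.Binary.Definitions using (tri<; tri≈; tri>)
open import Relation.Binary.PropositionalEquality
open import Relation.Nullary using (¬_; yes; no)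
open import Relation.Nullary.Reflects using (ofʸ; ofⁿ)

ℕtoℚ≡mkℚ : ∀ n → ℕtoℚ n ≡ mkℚ (ℤ.+ n) 0 (Coprime.sym (Coprime.1-coprimeTo n))
ℕtoℚ≡mkℚ n = ℚP.normalize-coprime (Coprime.sym (Coprime.1-coprimeTo n))

ℕtoℚ-homo-+ : ∀ m n → ℕtoℚ (m + n) ≡ ℕtoℚ m ℚ.+ ℕtoℚ n
ℕtoℚ-homo-+ m n = trans (ℚP./-cong numerators refl) (sym (cong₂ ℚ._+_ (ℕtoℚ≡mkℚ m) (ℕtoℚ≡mkℚ n)))
  where
  numerators : ℤ.+ m ℤ.+ ℤ.+ n ≡ ℤ.+ m ℤ.* ℤ.+ 1 ℤ.+ ℤ.+ n ℤ.* ℤ.+ 1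
  numerators = sym (cong₂ ℤ._+_ (ℤP.*-identityʳ (ℤ.+ m)) (ℤP.*-identityʳ (ℤ.+ n)))

ℕtoℚ-homo-* : ∀ m n → ℕtoℚ (m * n) ≡ ℕtoℚ m ℚ.* ℕtoℚ n
ℕtoℚ-homo-* m n = trans (ℚP./-cong (ℤP.pos-* m n) refl) (sym (cong₂ ℚ._*_ (ℕtoℚ≡mkℚ m) (ℕtoℚ≡mkℚ n)))

ℕtoℚ-mono-≤ : ∀ {m n} → m ≤ n → ℕtoℚ m ℚ.≤ ℕtoℚ n
ℕtoℚ-mono-≤ {m} {n} m≤n rewrite ℕtoℚ≡mkℚ m | ℕtoℚ≡mkℚ n = ℚ.*≤* (ℤP.*-monoʳ-≤-nonNeg (ℤ.+ 1) (ℤ.+≤+ m≤n))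

ℕtoℚ-nonNeg : ∀ n → ℚ.NonNegative (ℕtoℚ n)
ℕtoℚ-nonNeg n = ℚ.nonNegative (ℕtoℚ-mono-≤ {0} {n} z≤n)

ℕtoℚ-pos : ∀ n → ℚ.Positive (ℕtoℚ (suc n))
ℕtoℚ-pos n = subst ℚ.Positive (sym (ℕtoℚ≡mkℚ (suc n))) _

inv-nonNeg : ∀ n → ℚ.NonNegative (inv n)
inv-nonNeg zero    = _
inv-nonNeg (suc n) = subst ℚ.NonNegative (sym (ℚP.normalize-coprime (Coprime.1-coprimeTo (suc n)))) _

inv-inverseˡ : ∀ n → inv (suc n) ℚ.* ℕtoℚ (suc n) ≡ 1ℚ
inv-inverseˡ n = trans (cong₂ ℚ._*_ (ℚP.normalize-coprime (Coprime.1-coprimeTo (suc n))) (ℕtoℚ≡mkℚ (suc n)))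
                       (ℚP.*-inverseˡ (mkℚ (ℤ.+ suc n) 0 (Coprime.sym (Coprime.1-coprimeTo (suc n)))))

inv[m]≡n*inv[m*n] : ∀ m n → inv (suc m) ≡ ℕtoℚ (suc n) ℚ.* inv (suc m * suc n)
inv[m]≡n*inv[m*n] m n = begin
  i                                 ≡⟨ sym (ℚP.*-identityʳ i) ⟩
  i ℚ.* 1ℚ                          ≡⟨ cong (i ℚ.*_) (sym (inv-inverseˡ (n + m * suc n))) ⟩
  i ℚ.* (j ℚ.* ℕtoℚ (suc m * suc n)) ≡⟨ cong (λ t → i ℚ.* (j ℚ.* t)) (ℕtoℚ-homo-* (suc m) (suc n)) ⟩
  i ℚ.* (j ℚ.* (M ℚ.* N))           ≡⟨ regroup i j M N ⟩
  (i ℚ.* M) ℚ.* (N ℚ.* j)           ≡⟨ cong (ℚ._* (N ℚ.* j)) (inv-inverseˡ m) ⟩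
  1ℚ ℚ.* (N ℚ.* j)                  ≡⟨ ℚP.*-identityˡ _ ⟩
  N ℚ.* j                           ∎
  where
  open ≡-Reasoning
  open ℚSolver.+-*-Solver
  i = inv (suc m); j = inv (suc m * suc n); M = ℕtoℚ (suc m); N = ℕtoℚ (suc n)
  regroup : ∀ a b c d → a ℚ.* (b ℚ.* (c ℚ.* d)) ≡ (a ℚ.* c) ℚ.* (d ℚ.* b)
  regroup = solve 4 (λ a b c d → a :* (b :* (c :* d)) := (a :* c) :* (d :* b)) refl

recip-inverseˡ : ∀ p → ℚ.Positive p → recip p ℚ.* p ≡ 1ℚ
recip-inverseˡ p@(mkℚ +[1+ _ ] _ _) _ = ℚP.*-inverseˡ p

1≤⇒pos : ∀ {p} → 1ℚ ℚ.≤ p → ℚ.Positive p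
1≤⇒pos 1≤p = ℚ.positive (ℚP.<-≤-trans (ℚP.positive⁻¹ 1ℚ) 1≤p)

recip-antimono-≤ : ∀ {p q} → 1ℚ ℚ.≤ p → p ℚ.≤ q → recip q ℚ.≤ recip p
recip-antimono-≤ {p} {q} 1≤p p≤q = ℚP.*-cancelʳ-≤-pos (q ℚ.* p) {{pos-qp}}
  (subst₂ ℚ._≤_ (sym (cancel q p pos-q)) (sym (trans (cong (recip p ℚ.*_) (ℚP.*-comm q p)) (cancel p q pos-p))) p≤q)
  where
  open ℚSolver.+-*-Solver
  pos-p : ℚ.Positive p
  pos-p = 1≤⇒pos 1≤p
  pos-q : ℚ.Positive q
  pos-q = 1≤⇒pos (ℚP.≤-trans 1≤p p≤q)
  pos-qp : ℚ.Positive (q ℚ.* p)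
  pos-qp = ℚP.pos*pos⇒pos q {{pos-q}} p {{pos-p}}
  assoc : ∀ a b c → a ℚ.* (b ℚ.* c) ≡ (a ℚ.* b) ℚ.* c
  assoc = solve 3 (λ a b c → a :* (b :* c) := (a :* b) :* c) refl
  cancel : ∀ a b → ℚ.Positive a → recip a ℚ.* (a ℚ.* b) ≡ b
  cancel a b pos-a = trans (assoc (recip a) a b) (trans (cong (ℚ._* b) (recip-inverseˡ a pos-a)) (ℚP.*-identityˡ b))

÷'-antimonoʳ-≤ : ∀ n {p q} → 1ℚ ℚ.≤ p → p ℚ.≤ q → ℕtoℚ n ÷' q ℚ.≤ ℕtoℚ n ÷' p
÷'-antimonoʳ-≤ n 1≤p p≤q = ℚP.*-monoˡ-≤-nonNeg (ℕtoℚ n) {{ℕtoℚ-nonNeg n}} (recip-antimono-≤ 1≤p p≤q)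

+-cancelʳ-≤ : ∀ {p q} r → p ℚ.+ r ℚ.≤ q ℚ.+ r → p ℚ.≤ q
+-cancelʳ-≤ {p} {q} r p+r≤q+r = subst₂ ℚ._≤_ (cancel p) (cancel q) (ℚP.+-monoˡ-≤ (ℚ.- r) p+r≤q+r)
  where
  open ℚSolver.+-*-Solver
  cancel : ∀ a → a ℚ.+ r ℚ.+ ℚ.- r ≡ a
  cancel a = solve 2 (λ a r → a :+ r :+ :- r := a) refl a r

Gt-mono-≤ : (k : Real) {p q : ℚ} → p ℚ.≤ q → Gt k p → Gt k q
Gt-mono-≤ k {p} {q} p≤q k<p with ℚP.<-cmp p q
... | tri< p<q _ _ = upward k p<q k<p
... | tri≈ _ p≡q _ = subst (Gt k) p≡q k<p
... | tri> _ _ q<p = ⊥-elim (ℚP.<-irrefl refl (ℚP.<-≤-trans q<p p≤q))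

m+o≡n⇒m≤n : ∀ {m n} o → m + o ≡ n → m ≤ n
m+o≡n⇒m≤n {m} o refl = ℕP.m≤m+n m o

-- Both sides agree at x = q and x = q + 1; the slack is t (t + 1) where t is the distance to that pair.
[2q+1]x≤q[q+1]+x² : ∀ q x → (q + suc q) * x ≤ q * suc q + x * x
[2q+1]x≤q[q+1]+x² q x with x ≤? q
... | yes x≤q with ℕP.m≤n⇒∃[o]m+o≡n x≤q
...   | t , refl = m+o≡n⇒m≤n (t * suc t) (solve 2 (λ x t →
          (x :+ t :+ (con 1 :+ (x :+ t))) :* x :+ t :* (con 1 :+ t) := (x :+ t) :* (con 1 :+ (x :+ t)) :+ x :* x) refl x t)
  where open ℕSolver.+-*-Solver
[2q+1]x≤q[q+1]+x² q x | no x≰q with ℕP.m≤n⇒∃[o]m+o≡n (ℕP.≰⇒> x≰q)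
...   | t , refl = m+o≡n⇒m≤n (t * suc t) (solve 2 (λ q t →
          (q :+ (con 1 :+ q)) :* (con 1 :+ q :+ t) :+ t :* (con 1 :+ t) := q :* (con 1 :+ q) :+ (con 1 :+ q :+ t) :* (con 1 :+ q :+ t)) refl q t)
  where open ℕSolver.+-*-Solver

-- minus the slope of the chord of x ↦ 1/x over [q, q + 1]
chordSlope : ℕ → ℚ
chordSlope q = inv (q * suc q)

inv-above-chord : ∀ {q x} → 1 ≤ q → 1 ≤ x →
  ℕtoℚ (q + suc q) ℚ.* chordSlope q ℚ.≤ inv x ℚ.+ ℕtoℚ x ℚ.* chordSlope q
inv-above-chord {q@(suc q')} {x@(suc x')} (s≤s z≤n) (s≤s z≤n) =
  ℚP.*-cancelʳ-≤-pos (X ℚ.* R) {{ℚP.pos*pos⇒pos X {{ℕtoℚ-pos x'}} R {{ℕtoℚ-pos (q + q' * suc q)}}}}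
    (subst₂ ℚ._≤_ (sym lhs) (sym rhs) (ℕtoℚ-mono-≤ ([2q+1]x≤q[q+1]+x² q x)))
  where
  open ≡-Reasoning
  open ℚSolver.+-*-Solver
  c = chordSlope q
  R = ℕtoℚ (q * suc q)
  X = ℕtoℚ x
  T = ℕtoℚ (q + suc q)
  cR≡1 : c ℚ.* R ≡ 1ℚ
  cR≡1 = inv-inverseˡ (q + q' * suc q)
  lhs : T ℚ.* c ℚ.* (X ℚ.* R) ≡ ℕtoℚ ((q + suc q) * x)
  lhs = begin
    T ℚ.* c ℚ.* (X ℚ.* R)  ≡⟨ solve 4 (λ t c x r → t :* c :* (x :* r) := t :* x :* (c :* r)) refl T c X R ⟩
    T ℚ.* X ℚ.* (c ℚ.* R)  ≡⟨ cong (T ℚ.* X ℚ.*_) cR≡1 ⟩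
    T ℚ.* X ℚ.* 1ℚ         ≡⟨ ℚP.*-identityʳ _ ⟩
    T ℚ.* X                ≡⟨ sym (ℕtoℚ-homo-* (q + suc q) x) ⟩
    ℕtoℚ ((q + suc q) * x) ∎
  rhs : (inv x ℚ.+ X ℚ.* c) ℚ.* (X ℚ.* R) ≡ ℕtoℚ (q * suc q + x * x)
  rhs = begin
    (inv x ℚ.+ X ℚ.* c) ℚ.* (X ℚ.* R)
      ≡⟨ solve 4 (λ i c x r → (i :+ x :* c) :* (x :* r) := (i :* x) :* r :+ x :* x :* (c :* r)) refl (inv x) c X R ⟩
    (inv x ℚ.* X) ℚ.* R ℚ.+ X ℚ.* X ℚ.* (c ℚ.* R)
      ≡⟨ cong₂ (λ u v → u ℚ.* R ℚ.+ X ℚ.* X ℚ.* v) (inv-inverseˡ x') cR≡1 ⟩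
    1ℚ ℚ.* R ℚ.+ X ℚ.* X ℚ.* 1ℚ
      ≡⟨ cong₂ ℚ._+_ (ℚP.*-identityˡ R) (ℚP.*-identityʳ _) ⟩
    R ℚ.+ X ℚ.* X
      ≡⟨ sym (trans (ℕtoℚ-homo-+ (q * suc q) (x * x)) (cong (R ℚ.+_) (ℕtoℚ-homo-* x x))) ⟩
    ℕtoℚ (q * suc q + x * x) ∎

largeCount : ∀ {d} → ℕ → Vec ℕ d → ℕ
largeCount K []       = 0
largeCount K (x ∷ xs) = (if x <ᵇ K then 0 else 1) + largeCount K xs

smallSum : ∀ {d} → ℕ → Vec ℕ d → ℕ
smallSum K []       = 0
smallSum K (x ∷ xs) = (if x <ᵇ K then x else 0) + smallSum K xs

largeCount+smallCount≡length : ∀ {d} K (xs : Vec ℕ d) → largeCount K xs + smallCount K xs ≡ d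
largeCount+smallCount≡length K [] = refl
largeCount+smallCount≡length K (x ∷ xs) with x <ᵇ K
... | true  = trans (ℕP.+-suc _ _) (cong suc (largeCount+smallCount≡length K xs))
... | false = cong suc (largeCount+smallCount≡length K xs)

K*largeCount+smallSum≤vsum : ∀ {d} K (xs : Vec ℕ d) → K * largeCount K xs + smallSum K xs ≤ vsum xs
K*largeCount+smallSum≤vsum K [] = ℕP.≤-reflexive (trans (ℕP.+-identityʳ (K * 0)) (ℕP.*-zeroʳ K))
K*largeCount+smallSum≤vsum K (x ∷ xs) with x <ᵇ K | ℕP.<ᵇ-reflects-< x K
... | true | _ = subst (_≤ x + vsum xs) (x∙yz≈y∙xz x (K * largeCount K xs) (smallSum K xs))
                  (ℕP.+-monoʳ-≤ x (K*largeCount+smallSum≤vsum K xs))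
... | false | ofⁿ x≮K = subst (_≤ x + vsum xs) (sym (trans (cong (_+ smallSum K xs) (ℕP.*-suc K (largeCount K xs))) (ℕP.+-assoc K _ _)))
                  (ℕP.+-mono-≤ (ℕP.≮⇒≥ x≮K) (K*largeCount+smallSum≤vsum K xs))

c*smallCount≤smallSum : ∀ {c d} K {xs : Vec ℕ d} → All (c ≤_) xs → c * smallCount K xs ≤ smallSum K xs
c*smallCount≤smallSum {c} K [] = ℕP.≤-reflexive (ℕP.*-zeroʳ c)
c*smallCount≤smallSum {c} K {x ∷ xs} (c≤x ∷ c≤xs) with x <ᵇ K
... | true  = subst (_≤ x + smallSum K xs) (sym (ℕP.*-suc c (smallCount K xs))) (ℕP.+-mono-≤ c≤x (c*smallCount≤smallSum K c≤xs))
... | false = c*smallCount≤smallSum K c≤xs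

smallSum≤[K∸1]*smallCount : ∀ {d} K (xs : Vec ℕ d) → smallSum K xs ≤ (K ∸ 1) * smallCount K xs
smallSum≤[K∸1]*smallCount K [] = ℕP.≤-reflexive (sym (ℕP.*-zeroʳ (K ∸ 1)))
smallSum≤[K∸1]*smallCount K (x ∷ xs) with x <ᵇ K | ℕP.<ᵇ-reflects-< x K
... | true | ofʸ x<K = subst (x + smallSum K xs ≤_) (sym (ℕP.*-suc (K ∸ 1) (smallCount K xs)))
                         (ℕP.+-mono-≤ (ℕP.∸-monoˡ-≤ 1 x<K) (smallSum≤[K∸1]*smallCount K xs))
... | false | _ = smallSum≤[K∸1]*smallCount K xs

smallInvSum-above-chord : ∀ {q d} K {xs : Vec ℕ d} → 1 ≤ q → All (1 ≤_) xs →
  ℕtoℚ (smallCount K xs * (q + suc q)) ℚ.* chordSlope q ℚ.≤ smallInvSum K xs ℚ.+ ℕtoℚ (smallSum K xs) ℚ.* chordSlope q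
smallInvSum-above-chord {q} K _ [] = ℚP.≤-reflexive (trans (ℚP.*-zeroˡ c) (sym (trans (ℚP.+-identityˡ _) (ℚP.*-zeroˡ c))))
  where c = chordSlope q
smallInvSum-above-chord {q} K {x ∷ xs} 1≤q (1≤x ∷ 1≤xs) with x <ᵇ K
... | false = ℚP.≤-trans (smallInvSum-above-chord K 1≤q 1≤xs)
                (ℚP.≤-reflexive (cong (ℚ._+ ℕtoℚ (smallSum K xs) ℚ.* chordSlope q) (sym (ℚP.+-identityˡ (smallInvSum K xs)))))
... | true =
  subst₂ ℚ._≤_ (sym lhs) (sym rhs) (ℚP.+-mono-≤ (inv-above-chord 1≤q 1≤x) (smallInvSum-above-chord K 1≤q 1≤xs))
  where
  open ℚSolver.+-*-Solver
  c = chordSlope q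
  T = q + suc q
  n = smallCount K xs
  I = smallInvSum K xs
  S = smallSum K xs
  lhs : ℕtoℚ (suc n * T) ℚ.* c ≡ ℕtoℚ T ℚ.* c ℚ.+ ℕtoℚ (n * T) ℚ.* c
  lhs = trans (cong (ℚ._* c) (ℕtoℚ-homo-+ T (n * T))) (ℚP.*-distribʳ-+ c (ℕtoℚ T) (ℕtoℚ (n * T)))
  rhs : (inv x ℚ.+ I) ℚ.+ ℕtoℚ (x + S) ℚ.* c ≡ (inv x ℚ.+ ℕtoℚ x ℚ.* c) ℚ.+ (I ℚ.+ ℕtoℚ S ℚ.* c)
  rhs = trans (cong (λ t → (inv x ℚ.+ I) ℚ.+ t ℚ.* c) (ℕtoℚ-homo-+ x S))
              (solve 5 (λ i a I b c → (i :+ I) :+ (a :+ b) :* c := (i :+ a :* c) :+ (I :+ b :* c)) refl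
                 (inv x) (ℕtoℚ x) I (ℕtoℚ S) c)

-- Σ 1/xᵢ for the most balanced m-tuple with sum T = q m + d₁ (0 ≤ d₁ < m):
-- d₁ entries q + 1 and d₀ = m - d₁ entries q.
balancedInvSum : ℕ → ℕ → ℚ
balancedInvSum T m = ℕtoℚ (m ∸ nmod T m) ℚ.* inv (ndiv T m) ℚ.+ ℕtoℚ (nmod T m) ℚ.* inv (suc (ndiv T m))

0≤balancedInvSum : ∀ T m → 0ℚ ℚ.≤ balancedInvSum T m
0≤balancedInvSum T m = ℚP.nonNegative⁻¹ (balancedInvSum T m)
  {{ℚP.nonNeg+nonNeg⇒nonNeg (ℕtoℚ d₀ ℚ.* inv q) {{term d₀ q}} (ℕtoℚ d₁ ℚ.* inv (suc q)) {{term d₁ (suc q)}}}}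
  where
  q = ndiv T m; d₁ = nmod T m; d₀ = m ∸ d₁
  term : ∀ a b → ℚ.NonNegative (ℕtoℚ a ℚ.* inv b)
  term a b = ℚP.nonNeg*nonNeg⇒nonNeg (ℕtoℚ a) {{ℕtoℚ-nonNeg a}} (inv b) {{inv-nonNeg b}}

balanced-on-chord : ∀ {q} → 1 ≤ q → ∀ d₀ d₁ →
  ℕtoℚ d₀ ℚ.* inv q ℚ.+ ℕtoℚ d₁ ℚ.* inv (suc q) ℚ.+ ℕtoℚ (q * (d₀ + d₁) + d₁) ℚ.* chordSlope q
    ≡ ℕtoℚ ((d₀ + d₁) * (q + suc q)) ℚ.* chordSlope q
balanced-on-chord {q@(suc q')} (s≤s z≤n) d₀ d₁ = begin
  D₀ ℚ.* inv q ℚ.+ D₁ ℚ.* inv (suc q) ℚ.+ N ℚ.* c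
    ≡⟨ cong₂ (λ u v → D₀ ℚ.* u ℚ.+ D₁ ℚ.* v ℚ.+ N ℚ.* c) (inv[m]≡n*inv[m*n] q' q) inv[1+q]≡q*c ⟩
  D₀ ℚ.* (ℕtoℚ (suc q) ℚ.* c) ℚ.+ D₁ ℚ.* (ℕtoℚ q ℚ.* c) ℚ.+ N ℚ.* c
    ≡⟨ factor-c D₀ D₁ (ℕtoℚ (suc q)) (ℕtoℚ q) N ⟩
  (D₀ ℚ.* ℕtoℚ (suc q) ℚ.+ D₁ ℚ.* ℕtoℚ q ℚ.+ N) ℚ.* c
    ≡⟨ cong (ℚ._* c) (sym cast) ⟩
  ℕtoℚ (d₀ * suc q + d₁ * q + (q * (d₀ + d₁) + d₁)) ℚ.* c
    ≡⟨ cong (λ t → ℕtoℚ t ℚ.* c) numerator ⟩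
  ℕtoℚ ((d₀ + d₁) * (q + suc q)) ℚ.* c ∎
  where
  open ≡-Reasoning
  c = chordSlope q
  D₀ = ℕtoℚ d₀; D₁ = ℕtoℚ d₁; N = ℕtoℚ (q * (d₀ + d₁) + d₁)
  inv[1+q]≡q*c : inv (suc q) ≡ ℕtoℚ q ℚ.* c
  inv[1+q]≡q*c = trans (inv[m]≡n*inv[m*n] q q') (cong (λ t → ℕtoℚ q ℚ.* inv t) (ℕP.*-comm (suc q) q))
  cast : ℕtoℚ (d₀ * suc q + d₁ * q + (q * (d₀ + d₁) + d₁)) ≡ D₀ ℚ.* ℕtoℚ (suc q) ℚ.+ D₁ ℚ.* ℕtoℚ q ℚ.+ N
  cast = trans (ℕtoℚ-homo-+ (d₀ * suc q + d₁ * q) _)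
               (cong (ℚ._+ N) (trans (ℕtoℚ-homo-+ (d₀ * suc q) (d₁ * q))
                                     (cong₂ ℚ._+_ (ℕtoℚ-homo-* d₀ (suc q)) (ℕtoℚ-homo-* d₁ q))))
  numerator : d₀ * suc q + d₁ * q + (q * (d₀ + d₁) + d₁) ≡ (d₀ + d₁) * (q + suc q)
  numerator = solve 3 (λ d₀ d₁ q → d₀ :* (con 1 :+ q) :+ d₁ :* q :+ (q :* (d₀ :+ d₁) :+ d₁) := (d₀ :+ d₁) :* (q :+ (con 1 :+ q)))
                refl d₀ d₁ q
    where open ℕSolver.+-*-Solver
  factor-c : ∀ a b x y n → a ℚ.* (x ℚ.* c) ℚ.+ b ℚ.* (y ℚ.* c) ℚ.+ n ℚ.* c ≡ (a ℚ.* x ℚ.+ b ℚ.* y ℚ.+ n) ℚ.* c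
  factor-c a b x y n = solve 6 (λ a b x y n c → a :* (x :* c) :+ b :* (y :* c) :+ n :* c := (a :* x :+ b :* y :+ n) :* c)
                         refl a b x y n c
    where open ℚSolver.+-*-Solver

T≡ndiv*m+nmod : ∀ T {m} → 0 < m → T ≡ ndiv T m * m + nmod T m
T≡ndiv*m+nmod T {suc m} _ = trans (m≡m%n+[m/n]*n T (suc m)) (ℕP.+-comm (T ℕ.% suc m) _)

nmod<m : ∀ T {m} → 0 < m → nmod T m < m
nmod<m T {suc m} _ = m%n<n T (suc m)

module Balanced (T m : ℕ) (0<m : 0 < m) where
  q d₀ d₁ : ℕ
  q  = ndiv T m
  d₁ = nmod T m
  d₀ = m ∸ d₁

  T≡q*m+d₁ : T ≡ q * m + d₁
  T≡q*m+d₁ = T≡ndiv*m+nmod T 0<m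

  d₁<m : d₁ < m
  d₁<m = nmod<m T 0<m

  d₀+d₁≡m : d₀ + d₁ ≡ m
  d₀+d₁≡m = ℕP.m∸n+n≡m (ℕP.<⇒≤ d₁<m)

  c*m≤T⇒c≤q : ∀ {c} → c * m ≤ T → c ≤ q
  c*m≤T⇒c≤q {c} c*m≤T = ℕP.≤-pred (ℕP.*-cancelʳ-< m c (suc q) (ℕP.≤-<-trans c*m≤T T<[1+q]*m))
    where
    T<[1+q]*m : T < suc q * m
    T<[1+q]*m = subst (_< suc q * m) (sym T≡q*m+d₁)
                  (subst (q * m + d₁ <_) (ℕP.+-comm (q * m) m) (ℕP.+-monoʳ-< (q * m) d₁<m))

  q*m≤T : q * m ≤ T
  q*m≤T = subst (q * m ≤_) (sym T≡q*m+d₁) (ℕP.m≤m+n (q * m) d₁)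

  T≤c*m⇒q≤c : ∀ {c} → T ≤ c * m → q ≤ c
  T≤c*m⇒q≤c {c} T≤c*m = ℕP.*-cancelʳ-≤ q c m {{ℕ.>-nonZero 0<m}} (ℕP.≤-trans q*m≤T T≤c*m)

  T≤c*m⇒d₁≡0⊎q<c : ∀ {c} → T ≤ c * m → d₁ ≡ 0 ⊎ q < c
  T≤c*m⇒d₁≡0⊎q<c {c} T≤c*m with q ℕ.<? c
  ... | yes q<c = inj₂ q<c
  ... | no q≮c = inj₁ (ℕP.n≤0⇒n≡0 (ℕP.+-cancelˡ-≤ (q * m) d₁ 0 q*m+d₁≤q*m+0))
    where
    q*m+d₁≤q*m+0 : q * m + d₁ ≤ q * m + 0
    q*m+d₁≤q*m+0 = subst₂ _≤_ T≡q*m+d₁ (sym (ℕP.+-identityʳ (q * m)))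
                     (ℕP.≤-trans T≤c*m (ℕP.*-monoˡ-≤ m (ℕP.≮⇒≥ q≮c)))

balancedInvSum≤smallInvSum : ∀ {d} K {xs : Vec ℕ d} → All (1 ≤_) xs → 0 < smallCount K xs →
  balancedInvSum (smallSum K xs) (smallCount K xs) ℚ.≤ smallInvSum K xs
balancedInvSum≤smallInvSum K {xs} 1≤xs 0<m = +-cancelʳ-≤ (ℕtoℚ S ℚ.* c) (begin
  balancedInvSum S m ℚ.+ ℕtoℚ S ℚ.* c                   ≡⟨ cong (λ t → balancedInvSum S m ℚ.+ ℕtoℚ t ℚ.* c) S≡q*[d₀+d₁]+d₁ ⟩
  balancedInvSum S m ℚ.+ ℕtoℚ (q * (d₀ + d₁) + d₁) ℚ.* c ≡⟨ balanced-on-chord 1≤q d₀ d₁ ⟩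
  ℕtoℚ ((d₀ + d₁) * (q + suc q)) ℚ.* c                   ≡⟨ cong (λ t → ℕtoℚ (t * (q + suc q)) ℚ.* c) d₀+d₁≡m ⟩
  ℕtoℚ (m * (q + suc q)) ℚ.* c                           ≤⟨ smallInvSum-above-chord K 1≤q 1≤xs ⟩
  smallInvSum K xs ℚ.+ ℕtoℚ S ℚ.* c                      ∎)
  where
  open ℚP.≤-Reasoning
  S = smallSum K xs
  m = smallCount K xs
  open Balanced S m 0<m
  c = chordSlope q
  1≤q : 1 ≤ q
  1≤q = c*m≤T⇒c≤q (c*smallCount≤smallSum K 1≤xs)
  S≡q*[d₀+d₁]+d₁ : S ≡ q * (d₀ + d₁) + d₁
  S≡q*[d₀+d₁]+d₁ = trans T≡q*m+d₁ (cong (λ t → q * t + d₁) (sym d₀+d₁≡m))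

S4value-balanced : ∀ K z d s → s < d →
  S4value K z d s ≡ ℕtoℚ (d + (d ∸ s)) ÷' (1ℚ ℚ.+ balancedInvSum (z ∸ K * s) (d ∸ s))
S4value-balanced K z d s s<d =
  cong₂ _÷'_ (cong ℕtoℚ (trans (ℕP.+-assoc d d₀ d₁) (cong (d +_) d₀+d₁≡m)))
             (ℚP.+-assoc 1ℚ (ℕtoℚ d₀ ℚ.* inv q) (ℕtoℚ d₁ ℚ.* inv (suc q)))
  where open Balanced (z ∸ K * s) (d ∸ s) (ℕP.m<n⇒0<n∸m s<d)

vsum-++ : ∀ {m n} (xs : Vec ℕ m) (ys : Vec ℕ n) → vsum (xs ++ ys) ≡ vsum xs + vsum ys
vsum-++ []       ys = refl
vsum-++ (x ∷ xs) ys = trans (cong (x +_) (vsum-++ xs ys)) (sym (ℕP.+-assoc x _ _))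

smallCount-++ : ∀ {m n} K (xs : Vec ℕ m) (ys : Vec ℕ n) → smallCount K (xs ++ ys) ≡ smallCount K xs + smallCount K ys
smallCount-++ K []       ys = refl
smallCount-++ K (x ∷ xs) ys = trans (cong (b +_) (smallCount-++ K xs ys)) (sym (ℕP.+-assoc b _ _))
  where b = if x <ᵇ K then 1 else 0

smallInvSum-++ : ∀ {m n} K (xs : Vec ℕ m) (ys : Vec ℕ n) → smallInvSum K (xs ++ ys) ≡ smallInvSum K xs ℚ.+ smallInvSum K ys
smallInvSum-++ K []       ys = sym (ℚP.+-identityˡ _)
smallInvSum-++ K (x ∷ xs) ys = trans (cong (b ℚ.+_) (smallInvSum-++ K xs ys)) (sym (ℚP.+-assoc b _ _))
  where b = if x <ᵇ K then inv x else 0ℚ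

vsum-replicate : ∀ n y → vsum (replicate n y) ≡ n * y
vsum-replicate zero    y = refl
vsum-replicate (suc n) y = cong (y +_) (vsum-replicate n y)

All-replicate : ∀ {P : ℕ → Set} n {y} → P y → All P (replicate n y)
All-replicate zero    py = []
All-replicate (suc n) py = py ∷ All-replicate n py

smallCount-replicate-small : ∀ n {y K} → n ≡ 0 ⊎ y < K → smallCount K (replicate n y) ≡ n
smallCount-replicate-small zero _ = refl
smallCount-replicate-small (suc n) {y} {K} (inj₂ y<K) with y <ᵇ K | ℕP.<ᵇ-reflects-< y K
... | true  | _       = cong suc (smallCount-replicate-small n (inj₂ y<K))
... | false | ofⁿ y≮K = ⊥-elim (y≮K y<K)

smallInvSum-replicate-small : ∀ n {y K} → n ≡ 0 ⊎ y < K → smallInvSum K (replicate n y) ≡ ℕtoℚ n ℚ.* inv y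
smallInvSum-replicate-small zero {y} _ = sym (ℚP.*-zeroˡ (inv y))
smallInvSum-replicate-small (suc n) {y} {K} (inj₂ y<K) with y <ᵇ K | ℕP.<ᵇ-reflects-< y K
... | true  | _ = begin
  inv y ℚ.+ smallInvSum K (replicate n y)  ≡⟨ cong (inv y ℚ.+_) (smallInvSum-replicate-small n (inj₂ y<K)) ⟩
  inv y ℚ.+ ℕtoℚ n ℚ.* inv y               ≡⟨ cong (ℚ._+ ℕtoℚ n ℚ.* inv y) (sym (ℚP.*-identityˡ (inv y))) ⟩
  1ℚ ℚ.* inv y ℚ.+ ℕtoℚ n ℚ.* inv y        ≡⟨ sym (ℚP.*-distribʳ-+ (inv y) 1ℚ (ℕtoℚ n)) ⟩
  (1ℚ ℚ.+ ℕtoℚ n) ℚ.* inv y                ≡⟨ cong (ℚ._* inv y) (sym (ℕtoℚ-homo-+ 1 n)) ⟩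
  ℕtoℚ (suc n) ℚ.* inv y                   ∎
  where open ≡-Reasoning
... | false | ofⁿ y≮K = ⊥-elim (y≮K y<K)

smallCount-replicate-large : ∀ n {y K} → K ≤ y → smallCount K (replicate n y) ≡ 0
smallCount-replicate-large zero _ = refl
smallCount-replicate-large (suc n) {y} {K} K≤y with y <ᵇ K | ℕP.<ᵇ-reflects-< y K
... | true  | ofʸ y<K = ⊥-elim (ℕP.<⇒≱ y<K K≤y)
... | false | _       = smallCount-replicate-large n K≤y

smallInvSum-replicate-large : ∀ n {y K} → K ≤ y → smallInvSum K (replicate n y) ≡ 0ℚ
smallInvSum-replicate-large zero _ = refl
smallInvSum-replicate-large (suc n) {y} {K} K≤y with y <ᵇ K | ℕP.<ᵇ-reflects-< y K
... | true  | ofʸ y<K = ⊥-elim (ℕP.<⇒≱ y<K K≤y)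
... | false | _       = trans (ℚP.+-identityˡ _) (smallInvSum-replicate-large n K≤y)

module Extremal (K s T m : ℕ) (0<K : 0 < K) (0<m : 0 < m) (T≤[K∸1]*m : T ≤ (K ∸ 1) * m) where
  open Balanced T m 0<m public

  vec : Vec ℕ (s + (d₀ + d₁))
  vec = replicate s K ++ (replicate d₀ q ++ replicate d₁ (suc q))

  q<K : q < K
  q<K = ℕP.m≤pred[n]⇒suc[m]≤n {{ℕ.>-nonZero 0<K}} (T≤c*m⇒q≤c T≤[K∸1]*m)

  d₁≡0⊎1+q<K : d₁ ≡ 0 ⊎ suc q < K
  d₁≡0⊎1+q<K = Sum.map₂ (ℕP.m≤pred[n]⇒suc[m]≤n {{ℕ.>-nonZero 0<K}}) (T≤c*m⇒d₁≡0⊎q<c T≤[K∸1]*m)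

  vsum-vec : vsum vec ≡ K * s + T
  vsum-vec = begin
    vsum vec                                            ≡⟨ vsum-++ (replicate s K) _ ⟩
    vsum (replicate s K) + vsum (replicate d₀ q ++ _)   ≡⟨ cong (vsum (replicate s K) +_) (vsum-++ (replicate d₀ q) _) ⟩
    vsum (replicate s K) + (vsum (replicate d₀ q) + vsum (replicate d₁ (suc q)))
      ≡⟨ cong₂ (λ a b → a + (b + vsum (replicate d₁ (suc q)))) (vsum-replicate s K) (vsum-replicate d₀ q) ⟩
    s * K + (d₀ * q + vsum (replicate d₁ (suc q)))      ≡⟨ cong (λ b → s * K + (d₀ * q + b)) (vsum-replicate d₁ (suc q)) ⟩
    s * K + (d₀ * q + d₁ * suc q)                       ≡⟨ regroup ⟩
    K * s + (q * (d₀ + d₁) + d₁)                        ≡⟨ cong (λ t → K * s + (q * t + d₁)) d₀+d₁≡m ⟩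
    K * s + (q * m + d₁)                                ≡⟨ cong (K * s +_) (sym T≡q*m+d₁) ⟩
    K * s + T                                           ∎
    where
    open ≡-Reasoning
    regroup : s * K + (d₀ * q + d₁ * suc q) ≡ K * s + (q * (d₀ + d₁) + d₁)
    regroup = solve 5 (λ s K d₀ d₁ q → s :* K :+ (d₀ :* q :+ d₁ :* (con 1 :+ q)) := K :* s :+ (q :* (d₀ :+ d₁) :+ d₁))
                refl s K d₀ d₁ q
      where open ℕSolver.+-*-Solver

  smallCount-vec : smallCount K vec ≡ d₀ + d₁
  smallCount-vec =
    trans (smallCount-++ K (replicate s K) _)
          (cong₂ _+_ (smallCount-replicate-large s ℕP.≤-refl)
                     (trans (smallCount-++ K (replicate d₀ q) _)
                            (cong₂ _+_ (smallCount-replicate-small d₀ (inj₂ q<K)) (smallCount-replicate-small d₁ d₁≡0⊎1+q<K))))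

  smallInvSum-vec : smallInvSum K vec ≡ balancedInvSum T m
  smallInvSum-vec =
    trans (smallInvSum-++ K (replicate s K) _)
          (trans (cong₂ ℚ._+_ (smallInvSum-replicate-large s ℕP.≤-refl)
                              (trans (smallInvSum-++ K (replicate d₀ q) _)
                                     (cong₂ ℚ._+_ (smallInvSum-replicate-small d₀ (inj₂ q<K))
                                                  (smallInvSum-replicate-small d₁ d₁≡0⊎1+q<K))))
                 (ℚP.+-identityˡ _))

  All-vec : 2 ≤ K → 2 * m ≤ T → All (2 ≤_) vec
  All-vec 2≤K 2m≤T = ++⁺ (All-replicate s 2≤K) (++⁺ (All-replicate d₀ 2≤q) (All-replicate d₁ (ℕP.m≤n⇒m≤1+n 2≤q)))
    where
    2≤q : 2 ≤ q
    2≤q = c*m≤T⇒c≤q 2m≤T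

Dominated : (ℕ → Set) → (ℕ → Set) → Set
Dominated P Q = ∀ z → P z → Σ ℕ λ w → w ≤ z × Q w

IsMin-transfer : ∀ {P Q : ℕ → Set} → Dominated P Q → Dominated Q P → ∀ {z} → IsMin P z → IsMin Q z
IsMin-transfer {P} {Q} P≼Q Q≼P {z} (Pz , z-least) with P≼Q z Pz
... | w , w≤z , Qw = subst Q (ℕP.≤-antisym w≤z (z≤ w Qw)) Qw , z≤
  where
  z≤ : ∀ v → Q v → z ≤ v
  z≤ v Qv with Q≼P v Qv
  ... | u , u≤v , Pu = ℕP.≤-trans (z-least u Pu) u≤v

D2Prop-dominatedBy-Suitable : (k : Real) (K : ℕ) → 2 ≤ K → Dominated (D2Prop k K) (Suitable k K)
D2Prop-dominatedBy-Suitable k K 2≤K z (d , K≤d , x , 2≤x , Σx≡z , k<aad) with K * K ≤? z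
... | yes K²≤z = z , ℕP.≤-refl , ℕP.≤-trans (ℕP.*-mono-≤ 1≤K 1≤K) K²≤z , inj₁ K²≤z
  where
  1≤K : 1 ≤ K
  1≤K = ℕP.≤-trans (s≤s z≤n) 2≤K
... | no K²≰z = w , w≤z , 1≤w , inj₂ (d , s , (K≤d , 2d≤w) , s<d , (lo , hi) , Gt-mono-≤ k aad≤S4 k<aad)
  where
  s = largeCount K x
  m = smallCount K x
  S = smallSum K x
  w = K * s + S
  s+m≡d : s + m ≡ d
  s+m≡d = largeCount+smallCount≡length K x
  d∸s≡m : d ∸ s ≡ m
  d∸s≡m = trans (cong (_∸ s) (sym s+m≡d)) (ℕP.m+n∸m≡n s m)
  w≤z : w ≤ z
  w≤z = subst (w ≤_) Σx≡z (K*largeCount+smallSum≤vsum K x)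
  K*d≤w : m ≡ 0 → K * d ≤ w
  K*d≤w m≡0 = subst (λ t → K * t ≤ w) (trans (sym (ℕP.+-identityʳ s)) (trans (cong (s +_) (sym m≡0)) s+m≡d))
                (ℕP.m≤m+n (K * s) S)
  0<m : 0 < m
  0<m = ℕP.n≢0⇒n>0 λ m≡0 → K²≰z (ℕP.≤-trans (ℕP.*-monoʳ-≤ K K≤d) (ℕP.≤-trans (K*d≤w m≡0) w≤z))
  s<d : s < d
  s<d = subst (s <_) s+m≡d (ℕP.m<m+n s 0<m)
  2m≤S : 2 * m ≤ S
  2m≤S = c*smallCount≤smallSum K 2≤x
  2d≤w : 2 * d ≤ w
  2d≤w = subst (λ t → 2 * t ≤ w) s+m≡d
           (subst (_≤ w) (sym (ℕP.*-distribˡ-+ 2 s m)) (ℕP.+-mono-≤ (ℕP.*-monoˡ-≤ s 2≤K) 2m≤S))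
  1≤w : 1 ≤ w
  1≤w = ℕP.≤-trans (ℕP.≤-trans (ℕP.≤-trans (s≤s z≤n) (ℕP.≤-trans 2≤K K≤d)) (ℕP.m≤n*m d 2)) 2d≤w
  lo : K * s + 2 * (d ∸ s) ≤ w
  lo rewrite d∸s≡m = ℕP.+-monoʳ-≤ (K * s) 2m≤S
  hi : w ≤ K * s + (K ∸ 1) * (d ∸ s)
  hi rewrite d∸s≡m = ℕP.+-monoʳ-≤ (K * s) (smallSum≤[K∸1]*smallCount K x)
  aad≤S4 : aad* K x ℚ.≤ S4value K w d s
  aad≤S4 rewrite S4value-balanced K w d s s<d | d∸s≡m | ℕP.m+n∸m≡n (K * s) S =
    ÷'-antimonoʳ-≤ (d + m) (ℚP.≤-trans (ℚP.≤-reflexive (sym (ℚP.+-identityʳ 1ℚ))) (ℚP.+-monoʳ-≤ 1ℚ (0≤balancedInvSum S m)))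
      (ℚP.+-monoʳ-≤ 1ℚ (balancedInvSum≤smallInvSum K (All.map (ℕP.≤-trans (s≤s z≤n)) 2≤x) 0<m))

Suitable-dominatedBy-D2Prop : (k : Real) (K : ℕ) → 2 ≤ K → Gt k (ℕtoℚ K) → Dominated (Suitable k K) (D2Prop k K)
Suitable-dominatedBy-D2Prop k K 2≤K k<K z (_ , inj₁ K²≤z) =
  K * K , K²≤z , K , ℕP.≤-refl , replicate K K , All-replicate K 2≤K , vsum-replicate K K , subst (Gt k) (sym aad≡K) k<K
  where
  aad≡K : aad* K (replicate K K) ≡ ℕtoℚ K
  aad≡K = trans (cong₂ (λ a b → ℕtoℚ (K + a) ÷' (1ℚ ℚ.+ b)) (smallCount-replicate-large K ℕP.≤-refl) (smallInvSum-replicate-large K ℕP.≤-refl))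
                (trans (ℚP.*-identityʳ _) (cong ℕtoℚ (ℕP.+-identityʳ K)))
Suitable-dominatedBy-D2Prop k K 2≤K k<K z (_ , inj₂ (d , s , (K≤d , _) , s<d , (lo , hi) , k<S4)) =
  z , ℕP.≤-refl , s + (d₀ + d₁) , subst (K ≤_) (sym length≡d) K≤d , vec , All-vec 2≤K 2m≤T , Σvec≡z , subst (Gt k) (sym aad≡S4) k<S4
  where
  m = d ∸ s
  T = z ∸ K * s
  Ks≤z : K * s ≤ z
  Ks≤z = ℕP.≤-trans (ℕP.m≤m+n (K * s) _) lo
  2m≤T : 2 * m ≤ T
  2m≤T = subst (_≤ T) (ℕP.m+n∸m≡n (K * s) (2 * m)) (ℕP.∸-monoˡ-≤ (K * s) lo)
  T≤[K∸1]*m : T ≤ (K ∸ 1) * m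
  T≤[K∸1]*m = subst (T ≤_) (ℕP.m+n∸m≡n (K * s) _) (ℕP.∸-monoˡ-≤ (K * s) hi)
  open Extremal K s T m (ℕP.≤-trans (s≤s z≤n) 2≤K) (ℕP.m<n⇒0<n∸m s<d) T≤[K∸1]*m
  s+m≡d : s + m ≡ d
  s+m≡d = ℕP.m+[n∸m]≡n (ℕP.<⇒≤ s<d)
  length≡d : s + (d₀ + d₁) ≡ d
  length≡d = trans (cong (s +_) d₀+d₁≡m) s+m≡d
  Σvec≡z : vsum vec ≡ z
  Σvec≡z = trans vsum-vec (ℕP.m+[n∸m]≡n Ks≤z)
  aad≡S4 : aad* K vec ≡ S4value K z d s
  aad≡S4 = trans (cong₂ (λ a b → ℕtoℚ a ÷' (1ℚ ℚ.+ b)) (cong₂ _+_ length≡d (trans smallCount-vec d₀+d₁≡m)) smallInvSum-vec)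
                 (sym (S4value-balanced K z d s s<d))

¬Gt∧Gt⇒< : (k : Real) {m n : ℕ} → ¬ Gt k (ℕtoℚ m) → Gt k (ℕtoℚ n) → m < n
¬Gt∧Gt⇒< k {m} {n} k≥m k<n with n ≤? m
... | yes n≤m = ⊥-elim (k≥m (Gt-mono-≤ k (ℕtoℚ-mono-≤ n≤m) k<n))
... | no n≰m = ℕP.≰⇒> n≰m

lemma11 : (k : Real) → ¬ Gt k (ℕtoℚ 2) → (K : ℕ) → IsFloorSucc k K →
          (z : ℕ) → IsMin (D2Prop k K) z ⇔ IsMin (Suitable k K) z
lemma11 k k≥2 K (k<K , _) z = mk⇔ (IsMin-transfer D2≼Suitable Suitable≼D2) (IsMin-transfer Suitable≼D2 D2≼Suitable)
  where
  2≤K : 2 ≤ K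
  2≤K = ℕP.<⇒≤ (¬Gt∧Gt⇒< k k≥2 k<K)
  D2≼Suitable : Dominated (D2Prop k K) (Suitable k K)
  D2≼Suitable = D2Prop-dominatedBy-Suitable k K 2≤K
  Suitable≼D2 : Dominated (Suitable k K) (D2Prop k K)
  Suitable≼D2 = Suitable-dominatedBy-D2Prop k K 2≤K k<K
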